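{- Let $G=(V,E)$ be a directed graph with maximum outdegree $\beta\ge1$, let $\mathcal{C}$ be a color space, $m$ a positive integer, and let each node $v$ have a list $L_v\subseteq\mathcal{C}$. Set $\tau=\lceil 8\log\beta + 2\log\log|\mathcal{C}| + 2\log\log m\rceil+14$, $\tau'=2^{\tau-\lceil\log(2e\beta^2)\rceil}$, $k=\beta\tau$ and $k'=\beta\tau'$. Then (i) given a solution $(K_v)_{v\in V}$ of $P_2(\tau,k,\tau',k')$ (each node knowing its own $K_v$), a solution of $P_1(\tau,k)$ can be computed in one round of the LOCAL model; and (ii) given a solution $(C_v)_{v\in V}$ of $P_1(\tau,k)$, a solution of $P_0$ can be computed in one round of the LOCAL model. (All three problems are with respect to the same lists $(L_v)_{v\in V}$.)
   Context: Logarithms are base 2. $\mathcal{P}(S)$ denotes the power set of $S$. Problem $P_0$ (list coloring): each node $v$ outputs $c(v)\in L_v$ with adjacent nodes' colors distinct. Two sets $C,C'\subseteq\mathcal{C}$ $\tau$-conflict if $|C\cap C'|\ge\tau$. Problem $P_1(\tau,k)$: each node $v$ outputs $C_v\subseteq L_v$ with $|C_v|=k$ such that adjacent nodes' sets do not $\tau$-conflict. Two collections $K,K'\subseteq\mathcal{P}(\mathcal{C})$ $(\tau',\tau)$-conflict if there are sequences $C_1,\dots,C_{\tau'}\in K$ and $C'_1,\dots,C'_{\tau'}\in K'$, at least one of which consists of $\tau'$ distinct elements, such that $C_i$ and $C'_i$ $\tau$-conflict for every $1\le i\le\tau'$. Problem $P_2(\tau,k,\tau',k')$: each node $v$ outputs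 $K_v\subseteq\mathcal{P}(L_v)$ with $|K_v|=k'$ and $|C|=k$ for all $C\in K_v$, such that adjacent nodes' collections do not $(\tau',\tau)$-conflict. LOCAL model: synchronous rounds, unbounded messages to each neighbor per round (communication along edges regardless of orientation). -}

module Defs where

open import Data.Nat using (ℕ; zero; suc; _+_; _*_; _^_; _≤_; _<_; _!)
open import Data.Bool using (Bool; true; false)
open import Data.Fin using (Fin)
open import Data.Fin.Subset using (Subset; _∈_; _⊆_; _∩_; ∣_∣)
open import Data.Vec using (tabulate)
open import Data.List using (List; map; length)
open import Data.List.Relation.Unary.Unique.Propositional using (Unique)
import Data.List.Membership.Propositional as LM
open import Data.Product using (Σ; ∃; _×_; _,_)
open import Data.Sum using (_⊎_)
open import Function.Bundles using (_⇔_)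
open import Relation.Nullary using (¬_)
open import Relation.Binary.PropositionalEquality using (_≡_; _≢_)

record Digraph (n : ℕ) : Set where
  field
    adj         : Fin n → Fin n → Bool      -- adj v u ≡ true : edge v → u
    irreflexive : ∀ v → adj v v ≡ false
open Digraph public

outNbrs : ∀ {n} → Digraph n → Fin n → Subset n
outNbrs G v = tabulate (adj G v)

outdeg : ∀ {n} → Digraph n → Fin n → ℕ
outdeg G v = ∣ outNbrs G v ∣

MaxOutdeg : ℕ → ∀ {n} → Digraph n → Set
MaxOutdeg β G = (∀ v → outdeg G v ≤ β) × (∃ λ v → outdeg G v ≡ β)

Adjacent : ∀ {n} → Digraph n → Fin n → Fin n → Set
Adjacent G u v = adj G u v ≡ true ⊎ adj G v u ≡ true

Conflict : ∀ {c} → ℕ → Subset c → Subset c → Set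
Conflict τ C C' = τ ≤ ∣ C ∩ C' ∣

Distinct : ∀ {A : Set} {t} → (Fin t → A) → Set
Distinct f = ∀ i j → f i ≡ f j → i ≡ j

-- collections K, K' (finite sets of subsets, as duplicate-free lists)
-- (τ' , τ)-conflict
CollConflict : ∀ {c} → ℕ → ℕ → List (Subset c) → List (Subset c) → Set
CollConflict {c} τ' τ K K' =
  Σ (Fin τ' → Subset c) λ f → Σ (Fin τ' → Subset c) λ g →
    (∀ i → f i LM.∈ K) × (∀ i → g i LM.∈ K') ×
    (Distinct f ⊎ Distinct g) ×
    (∀ i → Conflict τ (f i) (g i))

IsP0 : ∀ {c n} → Digraph n → (Fin n → Subset c) → (Fin n → Fin c) → Set
IsP0 G L col = (∀ v → col v ∈ L v) × (∀ u v → Adjacent G u v → col u ≢ col v)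

IsP1 : ℕ → ℕ → ∀ {c n} → Digraph n → (Fin n → Subset c) → (Fin n → Subset c) → Set
IsP1 τ k G L Cs =
  (∀ v → Cs v ⊆ L v × ∣ Cs v ∣ ≡ k) ×
  (∀ u v → Adjacent G u v → ¬ Conflict τ (Cs u) (Cs v))

IsP2 : ℕ → ℕ → ℕ → ℕ → ∀ {c n} → Digraph n → (Fin n → Subset c) →
       (Fin n → List (Subset c)) → Set
IsP2 τ k τ' k' G L Ks =
  (∀ v → Unique (Ks v) × length (Ks v) ≡ k' ×
         (∀ C → C LM.∈ Ks v → C ⊆ L v × ∣ C ∣ ≡ k)) ×
  (∀ u v → Adjacent G u v → ¬ CollConflict τ' τ (Ks u) (Ks v))

-- A node knows its ID, its list, its input; in one round it learns, for
-- every incident directed edge (with its orientation), the neighbour's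
-- ID, list and input.  The neighbours arrive in an arbitrary order
-- (the algorithm must work for every enumeration).

data Dir : Set where
  outE inE : Dir

EdgeDir : ∀ {n} → Digraph n → Fin n → Dir → Fin n → Set
EdgeDir G v outE u = adj G v u ≡ true
EdgeDir G v inE  u = adj G u v ≡ true

NbrListing : ∀ {n} → Digraph n → (Fin n → List (Dir × Fin n)) → Set
NbrListing G nb =
  ∀ v → Unique (nb v) × (∀ d u → ((d , u) LM.∈ nb v) ⇔ EdgeDir G v d u)

NodeData : ℕ → Set → Set
NodeData c I = ℕ × Subset c × I

OneRoundAlg : ℕ → Set → Set → Set
OneRoundAlg c I O = NodeData c I → List (Dir × NodeData c I) → O

runOneRound : ∀ {c n I O} → OneRoundAlg c I O → (Fin n → List (Dir × Fin n)) →
              (Fin n → ℕ) → (Fin n → Subset c) → (Fin n → I) → Fin n → O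
runOneRound A nb ids L inp v =
  A (ids v , L v , inp v) (map (λ { (d , u) → d , (ids u , L u , inp u) }) (nb v))

-- "Given a solution of In (each node knowing its own part), a solution of
--  Out can be computed in one round of LOCAL" on graphs satisfying Cls.
OneRoundReduction : (c : ℕ) (I O : Set) →
  (Cls : ∀ {n} → Digraph n → Set) →
  (In  : ∀ {n} → Digraph n → (Fin n → Subset c) → (Fin n → I) → Set) →
  (Out : ∀ {n} → Digraph n → (Fin n → Subset c) → (Fin n → O) → Set) → Set
OneRoundReduction c I O Cls In Out =
  Σ (OneRoundAlg c I O) λ A →
    ∀ n (G : Digraph n) → Cls G →
    (ids : Fin n → ℕ) → (∀ u v → ids u ≡ ids v → u ≡ v) →
    (L : Fin n → Subset c) → (inp : Fin n → I) → In G L inp →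
    (nb : Fin n → List (Dir × Fin n)) → NbrListing G nb →
    Out G L (runOneRound A nb ids L inp)

-- Parameters (logs base 2, exact integer characterisations).

-- x = 8 log β + 2 log log c + 2 log log m  ≤  n   (for c, m ≥ 2)
-- ⇔ β⁸ (log c)² (log m)² ≤ 2ⁿ
-- ⇔ for all positive rationals a = p/q < log c and b = p'/q' < log m :
--      (a b)² β⁸ ≤ 2ⁿ
XLe : ℕ → ℕ → ℕ → ℕ → Set
XLe β c m n = ∀ p q p' q' →
  2 ^ suc p < c ^ suc q → 2 ^ suc p' < m ^ suc q' →
  (suc p * suc p') ^ 2 * β ^ 8 ≤ 2 ^ n * (suc q * suc q') ^ 2

-- t = ⌈ 8 log β + 2 log log c + 2 log log m ⌉
IsCeilX : ℕ → ℕ → ℕ → ℕ → Set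
IsCeilX β c m t = XLe β c m t × (∀ n → XLe β c m n → t ≤ n)

-- eNum N = Σ_{j=0}^{N} N!/j!   (so e = sup_N eNum N / N!)
eNum : ℕ → ℕ
eNum zero    = 1
eNum (suc N) = suc N * eNum N + 1

-- log (2 e β²) ≤ l  ⇔  2 β² e ≤ 2^l  ⇔  ∀ N, 2 β² · eNum N ≤ 2^l · N!
LogLe : ℕ → ℕ → Set
LogLe β l = ∀ N → 2 * β ^ 2 * eNum N ≤ 2 ^ l * N !

-- l = ⌈ log (2 e β²) ⌉
IsCeilLog : ℕ → ℕ → Set
IsCeilLog β l = LogLe β l × (∀ n → LogLe β n → l ≤ n)

-- Both reductions choose greedily against the inputs of the out-neighbours only. For an edge
-- u → v, node u avoids the input of v, which contains the output of v, so the outputs of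
-- adjacent nodes are compatible; it remains to see that a choice exists.
-- (ii) Each of the at most β out-neighbours' sets meets C_v in fewer than τ colours, so together
-- they cover fewer than βτ = |C_v| colours of C_v.
-- (i) As K_v and K_u do not (τ', τ)-conflict, fewer than τ' of the distinct members of K_v
-- conflict with a member of K_u, so fewer than βτ' = |K_v| members of K_v are excluded.
-- Only the positivity of β, τ and τ' matters, not their particular values.
module Submission where

open import Defs
open import Data.Nat
  using (ℕ; _+_; _*_; _∸_; _^_; _≤_; _<_; s≤s; z≤n; pred; NonZero; >-nonZero; ≢-nonZero)
open import Data.Nat.Properties
open import Data.Nat.ListAction using (sum)
open import Data.Bool using (true; false)
open import Data.Fin using (Fin; zero; suc; fromℕ<; inject≤)
open import Data.Fin.Properties using (inject≤-injective)
open import Data.Fin.Subset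
  using (Subset; _∈_; _∉_; _⊆_; _∩_; _∪_; ∁; ∣_∣; ⋃; ⊥; Empty; inside; outside)
open import Data.Fin.Subset.Properties
  using (nonempty?; x∈p∪q⁺; x∈p∩q⁺; x∈p∩q⁻; x∉∁p⇒x∈p; x∈∁p⇒x∉p; p⊆q⇒∣p∣≤∣q∣; ∩-zeroʳ; ∣⊥∣≡0;
         ∩-distribˡ-∪; ∩-comm; x∈p⇒∣p-x∣<∣p∣; x∈p∧x≢y⇒x∈p-y)
open import Data.Vec using ([]; _∷_)
open import Data.Vec.Properties using (lookup⇒[]=; lookup∘tabulate)
open import Data.List using (List; []; _∷_; length; map; filter; lookup)
open import Data.List.Properties using (map-∘; length-map; filter-accept)
open import Data.List.Relation.Unary.All using (All; []; _∷_)
import Data.List.Relation.Unary.All as All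
open import Data.List.Relation.Unary.All.Properties using (All¬⇒¬Any; ¬Any⇒All¬; ¬All⇒Any¬; map⁺)
open import Data.List.Relation.Unary.Any using (Any; here; there; any?)
import Data.List.Relation.Unary.Any as Any
open import Data.List.Relation.Unary.AllPairs using ([]; _∷_)
open import Data.List.Relation.Unary.Unique.Propositional using (Unique)
open import Data.List.Relation.Unary.Unique.Propositional.Properties using (filter⁺)
open import Data.List.Membership.Propositional using (find; lose) renaming (_∈_ to _∈L_)
open import Data.List.Membership.Propositional.Properties using (∈-map⁺; ∈-lookup; ∈-filter⁻)
open import Data.Product using (Σ; ∃; _×_; _,_; proj₁; proj₂; map₂)
open import Data.Sum using (inj₁; inj₂)
open import Data.Empty using (⊥-elim)
open import Function using (_∘_)
open import Function.Bundles using (module Equivalence)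
open import Relation.Nullary using (¬_; Dec; yes; no; ¬?; does; contradiction)
open import Relation.Nullary.Decidable using (map′; decidable-stable)
open import Relation.Unary using (Decidable)
open import Relation.Binary using (Symmetric)
open import Relation.Binary.PropositionalEquality
  using (_≡_; _≢_; refl; sym; trans; cong; subst; ≢-sym; module ≡-Reasoning)

choose : ∀ {A : Set} {P : A → Set} → A → Dec (∃ P) → A
choose _ (yes (x , _)) = x
choose d (no _)        = d

choose-satisfies : ∀ {A : Set} {P : A → Set} (d : A) (P? : Dec (∃ P)) → ¬ ¬ ∃ P → P (choose d P?)
choose-satisfies _ (yes (_ , px)) _    = px
choose-satisfies _ (no ¬∃P)       ¬¬∃P = contradiction ¬∃P ¬¬∃P

∃∈? : ∀ {A : Set} {P : A → Set} → Decidable P → (xs : List A) → Dec (∃ λ x → x ∈L xs × P x)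
∃∈? P? xs = map′ find (λ (_ , x∈xs , px) → lose x∈xs px) (any? P? xs)

lookup-injective : ∀ {A : Set} {xs : List A} → Unique xs → ∀ i j → lookup xs i ≡ lookup xs j → i ≡ j
lookup-injective {xs = _ ∷ _}  _            zero    zero    _  = refl
lookup-injective {xs = _ ∷ xs} (x∉xs ∷ _)   zero    (suc j) x≡ =
  ⊥-elim (All¬⇒¬Any x∉xs (subst (_∈L xs) (sym x≡) (∈-lookup j)))
lookup-injective {xs = _ ∷ xs} (x∉xs ∷ _)   (suc i) zero    ≡x =
  ⊥-elim (All¬⇒¬Any x∉xs (subst (_∈L xs) ≡x (∈-lookup i)))
lookup-injective {xs = _ ∷ _}  (_ ∷ unique) (suc i) (suc j) eq = cong suc (lookup-injective unique i j eq)

Unique⇒distinct-family : ∀ {A : Set} {xs : List A} {t} → Unique xs → t ≤ length xs →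
                         Σ (Fin t → A) λ f → Distinct f × (∀ i → f i ∈L xs)
Unique⇒distinct-family {A} {xs} {t} unique t≤ =
  pick ,
  (λ i j eq → inject≤-injective t≤ t≤ i j (lookup-injective unique _ _ eq)) ,
  (λ i → ∈-lookup (inject≤ i t≤))
  where
  pick : Fin t → A
  pick i = lookup xs (inject≤ i t≤)

sum-map-mono : ∀ {A : Set} {f g : A → ℕ} → (∀ x → f x ≤ g x) → ∀ xs → sum (map f xs) ≤ sum (map g xs)
sum-map-mono f≤g []       = z≤n
sum-map-mono f≤g (x ∷ xs) = +-mono-≤ (f≤g x) (sum-map-mono f≤g xs)

sum-map-mono-< : ∀ {A : Set} {f g : A → ℕ} {xs} → (∀ x → f x ≤ g x) →
                 Any (λ x → f x < g x) xs → sum (map f xs) < sum (map g xs)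
sum-map-mono-< {xs = _ ∷ xs} f≤g (here fx<gx) = +-mono-<-≤ fx<gx (sum-map-mono f≤g xs)
sum-map-mono-< {xs = x ∷ _}  f≤g (there f<g)  = +-mono-≤-< (f≤g x) (sum-map-mono-< f≤g f<g)

sum-map-≤-* : ∀ {A : Set} {f : A → ℕ} {T xs} → All (λ x → f x ≤ T) xs → sum (map f xs) ≤ length xs * T
sum-map-≤-* []           = z≤n
sum-map-≤-* (fx≤T ∷ f≤T) = +-mono-≤ fx≤T (sum-map-≤-* f≤T)

sum-map-<-* : ∀ {A : Set} {f : A → ℕ} {T β xs} .{{_ : NonZero β}} .{{_ : NonZero T}} →
              All (λ x → f x < T) xs → length xs ≤ β → sum (map f xs) < β * T
sum-map-<-* {f = f} {T} {β} {xs} f<T length≤β = begin-strict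
  sum (map f xs)      ≤⟨ sum-map-≤-* (All.map <⇒≤pred f<T) ⟩
  length xs * pred T  ≤⟨ *-monoˡ-≤ (pred T) length≤β ⟩
  β * pred T          <⟨ *-monoʳ-< β (m≤pred[n]⇒suc[m]≤n ≤-refl) ⟩
  β * T               ∎
  where open ≤-Reasoning

module _ {A : Set} {P : A → Set} (P? : Decidable P) where

  length-filter-∷ : ∀ x xs → length (filter P? xs) ≤ length (filter P? (x ∷ xs))
  length-filter-∷ x xs with does (P? x)
  ... | true  = n≤1+n _
  ... | false = ≤-refl

  length-filter-∷-accept : ∀ {x} xs → P x → length (filter P? xs) < length (filter P? (x ∷ xs))
  length-filter-∷-accept xs px = ≤-reflexive (cong length (sym (filter-accept P? px)))

-- Double counting the pairs (u , x) with P u x: every x is counted at least once.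
length≤sum-length-filter : ∀ {A U : Set} {P : U → A → Set} (P? : ∀ u → Decidable (P u)) us xs →
  All (λ x → Any (λ u → P u x) us) xs → length xs ≤ sum (map (λ u → length (filter (P? u) xs)) us)
length≤sum-length-filter P? us []       []                = z≤n
length≤sum-length-filter P? us (x ∷ xs) (covered ∷ cover) =
  ≤-trans (s≤s (length≤sum-length-filter P? us xs cover))
          (sum-map-mono-< (λ u → length-filter-∷ (P? u) x xs)
                          (Any.map (λ {u} → length-filter-∷-accept (P? u) xs) covered))

∣p∪q∣≤∣p∣+∣q∣ : ∀ {n} (p q : Subset n) → ∣ p ∪ q ∣ ≤ ∣ p ∣ + ∣ q ∣
∣p∪q∣≤∣p∣+∣q∣ []            []            = z≤n
∣p∪q∣≤∣p∣+∣q∣ (inside ∷ p)  (inside ∷ q)  =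
  s≤s (≤-trans (∣p∪q∣≤∣p∣+∣q∣ p q) (≤-trans (n≤1+n _) (≤-reflexive (sym (+-suc _ _)))))
∣p∪q∣≤∣p∣+∣q∣ (inside ∷ p)  (outside ∷ q) = s≤s (∣p∪q∣≤∣p∣+∣q∣ p q)
∣p∪q∣≤∣p∣+∣q∣ (outside ∷ p) (inside ∷ q)  =
  ≤-trans (s≤s (∣p∪q∣≤∣p∣+∣q∣ p q)) (≤-reflexive (sym (+-suc _ _)))
∣p∪q∣≤∣p∣+∣q∣ (outside ∷ p) (outside ∷ q) = ∣p∪q∣≤∣p∣+∣q∣ p q

∣p∩⋃qs∣≤sum : ∀ {n} (p : Subset n) qs → ∣ p ∩ ⋃ qs ∣ ≤ sum (map (λ q → ∣ p ∩ q ∣) qs)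
∣p∩⋃qs∣≤sum {n} p []       = ≤-reflexive (begin
  ∣ p ∩ ⊥ ∣       ≡⟨ cong ∣_∣ (∩-zeroʳ p) ⟩
  ∣ ⊥ {n = n} ∣   ≡⟨ ∣⊥∣≡0 n ⟩
  0               ∎)
  where open ≡-Reasoning
∣p∩⋃qs∣≤sum p (q ∷ qs) = begin
  ∣ p ∩ (q ∪ ⋃ qs) ∣        ≡⟨ cong ∣_∣ (∩-distribˡ-∪ p q (⋃ qs)) ⟩
  ∣ p ∩ q ∪ p ∩ ⋃ qs ∣      ≤⟨ ∣p∪q∣≤∣p∣+∣q∣ (p ∩ q) (p ∩ ⋃ qs) ⟩
  ∣ p ∩ q ∣ + ∣ p ∩ ⋃ qs ∣  ≤⟨ +-monoʳ-≤ ∣ p ∩ q ∣ (∣p∩⋃qs∣≤sum p qs) ⟩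
  sum (map (λ q → ∣ p ∩ q ∣) (q ∷ qs)) ∎
  where open ≤-Reasoning

x∈⋃⁺ : ∀ {n} {x : Fin n} {p ps} → x ∈ p → p ∈L ps → x ∈ ⋃ ps
x∈⋃⁺ x∈p (here refl)  = x∈p∪q⁺ (inj₁ x∈p)
x∈⋃⁺ x∈p (there p∈ps) = x∈p∪q⁺ (inj₂ (x∈⋃⁺ x∈p p∈ps))

Empty[p∩∁q]⇒p⊆q : ∀ {n} {p q : Subset n} → Empty (p ∩ ∁ q) → p ⊆ q
Empty[p∩∁q]⇒p⊆q empty {x} x∈p = x∉∁p⇒x∈p (λ x∈∁q → empty (x , x∈p∩q⁺ (x∈p , x∈∁q)))

length≤∣p∣ : ∀ {n} {xs : List (Fin n)} {p : Subset n} →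
             Unique xs → (∀ {x} → x ∈L xs → x ∈ p) → length xs ≤ ∣ p ∣
length≤∣p∣ {xs = []}     []              _    = z≤n
length≤∣p∣ {xs = x ∷ xs} (x∉xs ∷ unique) xs⊆p =
  ≤-trans (s≤s (length≤∣p∣ unique (λ y∈xs → x∈p∧x≢y⇒x∈p-y (xs⊆p (there y∈xs)) (y≢x y∈xs))))
          (x∈p⇒∣p-x∣<∣p∣ (xs⊆p (here refl)))
  where
  y≢x : ∀ {y} → y ∈L xs → y ≢ x
  y≢x y∈xs refl = All¬⇒¬Any x∉xs y∈xs

outTargets : ∀ {A : Set} → List (Dir × A) → List A
outTargets []                = []
outTargets ((outE , a) ∷ xs) = a ∷ outTargets xs
outTargets ((inE  , _) ∷ xs) = outTargets xs

∈-outTargets⁺ : ∀ {A : Set} {a : A} xs → (outE , a) ∈L xs → a ∈L outTargets xs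
∈-outTargets⁺ ((outE , _) ∷ xs) (here refl) = here refl
∈-outTargets⁺ ((outE , _) ∷ xs) (there a∈)  = there (∈-outTargets⁺ xs a∈)
∈-outTargets⁺ ((inE  , _) ∷ xs) (there a∈)  = ∈-outTargets⁺ xs a∈

∈-outTargets⁻ : ∀ {A : Set} {a : A} xs → a ∈L outTargets xs → (outE , a) ∈L xs
∈-outTargets⁻ ((outE , _) ∷ xs) (here refl) = here refl
∈-outTargets⁻ ((outE , _) ∷ xs) (there a∈)  = there (∈-outTargets⁻ xs a∈)
∈-outTargets⁻ ((inE  , _) ∷ xs) a∈          = there (∈-outTargets⁻ xs a∈)

outTargets-unique : ∀ {A : Set} {xs : List (Dir × A)} → Unique xs → Unique (outTargets xs)
outTargets-unique {xs = []}              []              = []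
outTargets-unique {xs = (outE , a) ∷ xs} (a∉xs ∷ unique) =
  ¬Any⇒All¬ (outTargets xs) (All¬⇒¬Any a∉xs ∘ ∈-outTargets⁻ xs) ∷ outTargets-unique unique
outTargets-unique {xs = (inE  , _) ∷ xs} (_ ∷ unique)    = outTargets-unique unique

outTargets-map₂ : ∀ {A B : Set} (f : A → B) xs → outTargets (map (map₂ f) xs) ≡ map f (outTargets xs)
outTargets-map₂ f []                = refl
outTargets-map₂ f ((outE , a) ∷ xs) = cong (f a ∷_) (outTargets-map₂ f xs)
outTargets-map₂ f ((inE  , _) ∷ xs) = outTargets-map₂ f xs

outInputs : ∀ {c I} → List (Dir × NodeData c I) → List I
outInputs msgs = map (proj₂ ∘ proj₂) (outTargets msgs)

outRule : ∀ {c I O} → (I → List I → O) → OneRoundAlg c I O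
outRule f (_ , _ , x) msgs = f x (outInputs msgs)

runOneRound-outRule : ∀ {c I O n} (f : I → List I → O) nb (ids : Fin n → ℕ) (L : Fin n → Subset c) inp v →
  runOneRound (outRule f) nb ids L inp v ≡ f (inp v) (map inp (outTargets (nb v)))
runOneRound-outRule {c} {I} {n = n} f nb ids L inp v = cong (f (inp v)) (begin
  map (proj₂ ∘ proj₂) (outTargets (map (map₂ nodeData) (nb v)))
    ≡⟨ cong (map (proj₂ ∘ proj₂)) (outTargets-map₂ nodeData (nb v)) ⟩
  map (proj₂ ∘ proj₂) (map nodeData (outTargets (nb v)))
    ≡⟨ sym (map-∘ (outTargets (nb v))) ⟩
  map inp (outTargets (nb v))
    ∎)
  where
  open ≡-Reasoning
  nodeData : Fin n → NodeData c I
  nodeData u = ids u , L u , inp u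

Adjacent-elim : ∀ {n} (G : Digraph n) {R : Fin n → Fin n → Set} → Symmetric R →
                (∀ {u v} → adj G u v ≡ true → R u v) → ∀ u v → Adjacent G u v → R u v
Adjacent-elim G sym-R edge⇒R u v (inj₁ u→v) = edge⇒R u→v
Adjacent-elim G sym-R edge⇒R u v (inj₂ v→u) = sym-R (edge⇒R v→u)

module OutNeighbours {n} (G : Digraph n) (nb : Fin n → List (Dir × Fin n)) (listing : NbrListing G nb) where

  outs : Fin n → List (Fin n)
  outs v = outTargets (nb v)

  ∈-outs⇒adj : ∀ {v u} → u ∈L outs v → adj G v u ≡ true
  ∈-outs⇒adj {v} {u} u∈ = Equivalence.to (proj₂ (listing v) outE u) (∈-outTargets⁻ (nb v) u∈)

  adj⇒∈-outs : ∀ {v u} → adj G v u ≡ true → u ∈L outs v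
  adj⇒∈-outs {v} {u} v→u = ∈-outTargets⁺ (nb v) (Equivalence.from (proj₂ (listing v) outE u) v→u)

  length-outs≤outdeg : ∀ v → length (outs v) ≤ outdeg G v
  length-outs≤outdeg v = length≤∣p∣ (outTargets-unique (proj₁ (listing v))) (λ {u} u∈ →
    lookup⇒[]= u (outNbrs G v) (trans (lookup∘tabulate (adj G v) u) (∈-outs⇒adj u∈)))

  length-map-outs≤ : ∀ {β} {A : Set} (f : Fin n → A) → (∀ v → outdeg G v ≤ β) →
                     ∀ v → length (map f (outs v)) ≤ β
  length-map-outs≤ {β} f outdeg≤β v = begin
    length (map f (outs v))  ≡⟨ length-map f (outs v) ⟩
    length (outs v)          ≤⟨ length-outs≤outdeg v ⟩
    outdeg G v               ≤⟨ outdeg≤β v ⟩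
    β                        ∎
    where open ≤-Reasoning

freshColour : ∀ {c} → Fin c → Subset c → List (Subset c) → Fin c
freshColour d C Cs = choose d (nonempty? (C ∩ ∁ (⋃ Cs)))

freshColour-spec : ∀ {c} (d : Fin c) C Cs → sum (map (λ C' → ∣ C ∩ C' ∣) Cs) < ∣ C ∣ →
                   freshColour d C Cs ∈ C × All (freshColour d C Cs ∉_) Cs
freshColour-spec d C Cs covered<∣C∣ =
  x∈C , All.tabulate (λ C'∈Cs x∈C' → x∈∁p⇒x∉p x∈∁⋃Cs (x∈⋃⁺ x∈C' C'∈Cs))
  where
  C⊈⋃Cs : ¬ Empty (C ∩ ∁ (⋃ Cs))
  C⊈⋃Cs empty = <⇒≱ covered<∣C∣ (begin
    ∣ C ∣                             ≤⟨ p⊆q⇒∣p∣≤∣q∣ (λ x∈C → x∈p∩q⁺ (x∈C , C⊆⋃Cs x∈C)) ⟩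
    ∣ C ∩ ⋃ Cs ∣                      ≤⟨ ∣p∩⋃qs∣≤sum C Cs ⟩
    sum (map (λ C' → ∣ C ∩ C' ∣) Cs)  ∎)
    where
    open ≤-Reasoning
    C⊆⋃Cs : C ⊆ ⋃ Cs
    C⊆⋃Cs = Empty[p∩∁q]⇒p⊆q empty
  x∈C∩∁⋃Cs : freshColour d C Cs ∈ C ∩ ∁ (⋃ Cs)
  x∈C∩∁⋃Cs = choose-satisfies d (nonempty? (C ∩ ∁ (⋃ Cs))) C⊈⋃Cs
  x∈C : freshColour d C Cs ∈ C
  x∈C = proj₁ (x∈p∩q⁻ C _ x∈C∩∁⋃Cs)
  x∈∁⋃Cs : freshColour d C Cs ∈ ∁ (⋃ Cs)
  x∈∁⋃Cs = proj₂ (x∈p∩q⁻ C _ x∈C∩∁⋃Cs)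

p1⇒p0 : ∀ c β τ .{{_ : NonZero β}} .{{_ : NonZero τ}} → Fin c →
        OneRoundReduction c (Subset c) (Fin c) (MaxOutdeg β) (IsP1 τ (β * τ)) IsP0
p1⇒p0 c β τ d = outRule (freshColour d) , correct
  where
  correct : ∀ n (G : Digraph n) → MaxOutdeg β G →
    (ids : Fin n → ℕ) → (∀ u v → ids u ≡ ids v → u ≡ v) →
    (L : Fin n → Subset c) → (Cs : Fin n → Subset c) → IsP1 τ (β * τ) G L Cs →
    (nb : Fin n → List (Dir × Fin n)) → NbrListing G nb →
    IsP0 G L (runOneRound (outRule (freshColour d)) nb ids L Cs)
  correct n G (outdeg≤β , _) ids _ L Cs (valid , noConflict) nb listing =
    (λ v → proj₁ (valid v) (proj₁ (spec v))) ,
    Adjacent-elim G ≢-sym (λ {u} {v} u→v col≡ →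
      All.lookup (proj₂ (spec u)) (∈-map⁺ Cs (adj⇒∈-outs u→v))
                 (subst (_∈ Cs v) (sym col≡) (proj₁ (spec v))))
    where
    open OutNeighbours G nb listing
    col : Fin n → Fin c
    col = runOneRound (outRule (freshColour d)) nb ids L Cs
    spec : ∀ v → col v ∈ Cs v × All (col v ∉_) (map Cs (outs v))
    spec v = subst (λ x → x ∈ Cs v × All (x ∉_) (map Cs (outs v)))
                   (sym (runOneRound-outRule (freshColour d) nb ids L Cs v))
                   (freshColour-spec d (Cs v) (map Cs (outs v))
                     (≤-trans covered<βτ (≤-reflexive (sym (proj₂ (valid v))))))
      where
      covered<βτ : sum (map (λ C' → ∣ Cs v ∩ C' ∣) (map Cs (outs v))) < β * τ
      covered<βτ = sum-map-<-*
        (map⁺ (All.tabulate (λ u∈ → ≰⇒> (noConflict v _ (inj₁ (∈-outs⇒adj u∈))))))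
        (length-map-outs≤ Cs outdeg≤β v)

Conflict-sym : ∀ {c τ} {C C' : Subset c} → Conflict τ C C' → Conflict τ C' C
Conflict-sym {τ = τ} {C} {C'} = subst (τ ≤_) (cong ∣_∣ (∩-comm C C'))

ConflictsWithSome : ∀ {c} → ℕ → List (Subset c) → Subset c → Set
ConflictsWithSome τ K C = Any (Conflict τ C) K

conflictsWithSome? : ∀ {c} τ (K : List (Subset c)) → Decidable (ConflictsWithSome τ K)
conflictsWithSome? τ K C = any? (λ C' → τ ≤? ∣ C ∩ C' ∣) K

Compatible : ∀ {c} → ℕ → List (List (Subset c)) → Subset c → Set
Compatible τ Ks C = All (λ K → ¬ ConflictsWithSome τ K C) Ks

compatible? : ∀ {c} τ (Ks : List (List (Subset c))) → Decidable (Compatible τ Ks)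
compatible? τ Ks C = All.all? (λ K → ¬? (conflictsWithSome? τ K C)) Ks

compatibleMember : ∀ {c} → ℕ → List (Subset c) → List (List (Subset c)) → Subset c
compatibleMember τ K Ks = choose ⊥ (∃∈? (compatible? τ Ks) K)

compatibleMember-spec : ∀ {c} τ K (Ks : List (List (Subset c))) →
  sum (map (λ K' → length (filter (conflictsWithSome? τ K') K)) Ks) < length K →
  compatibleMember τ K Ks ∈L K × Compatible τ Ks (compatibleMember τ K Ks)
compatibleMember-spec τ K Ks excluded<∣K∣ =
  choose-satisfies ⊥ (∃∈? (compatible? τ Ks) K) someCompatible
  where
  excluding : ∀ {C} → ¬ Compatible τ Ks C → Any (λ K' → ConflictsWithSome τ K' C) Ks
  excluding {C} incompatible =
    Any.map (λ {K'} → decidable-stable (conflictsWithSome? τ K' C))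
            (¬All⇒Any¬ (λ K' → ¬? (conflictsWithSome? τ K' C)) Ks incompatible)
  someCompatible : ¬ ¬ ∃ λ C → C ∈L K × Compatible τ Ks C
  someCompatible none = <⇒≱ excluded<∣K∣
    (length≤sum-length-filter (conflictsWithSome? τ) Ks K
      (All.tabulate (λ {C} C∈K → excluding {C} (λ compatible → none (C , C∈K , compatible)))))

length-filter-conflicting< : ∀ {c} τ τ' {K K' : List (Subset c)} → Unique K → ¬ CollConflict τ' τ K K' →
                             length (filter (conflictsWithSome? τ K') K) < τ'
length-filter-conflicting< {c} τ τ' {K} {K'} unique noCollConflict = ≰⇒> (noCollConflict ∘ collConflict)
  where
  conflicting : List (Subset c)
  conflicting = filter (conflictsWithSome? τ K') K
  collConflict : τ' ≤ length conflicting → CollConflict τ' τ K K'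
  collConflict τ'≤ with Unique⇒distinct-family (filter⁺ (conflictsWithSome? τ K') unique) τ'≤
  ... | f , distinct , f∈ =
    f , proj₁ ∘ partner , (λ i → proj₁ (∈-filter⁻ (conflictsWithSome? τ K') {xs = K} (f∈ i))) ,
    proj₁ ∘ proj₂ ∘ partner , inj₁ distinct , proj₂ ∘ proj₂ ∘ partner
    where
    partner : ∀ i → ∃ λ C' → C' ∈L K' × Conflict τ (f i) C'
    partner i = find (proj₂ (∈-filter⁻ (conflictsWithSome? τ K') {xs = K} (f∈ i)))

p2⇒p1 : ∀ c β τ k τ' .{{_ : NonZero β}} .{{_ : NonZero τ'}} →
        OneRoundReduction c (List (Subset c)) (Subset c) (MaxOutdeg β) (IsP2 τ k τ' (β * τ')) (IsP1 τ k)
p2⇒p1 c β τ k τ' = outRule (compatibleMember τ) , correct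
  where
  correct : ∀ n (G : Digraph n) → MaxOutdeg β G →
    (ids : Fin n → ℕ) → (∀ u v → ids u ≡ ids v → u ≡ v) →
    (L : Fin n → Subset c) → (Ks : Fin n → List (Subset c)) → IsP2 τ k τ' (β * τ') G L Ks →
    (nb : Fin n → List (Dir × Fin n)) → NbrListing G nb →
    IsP1 τ k G L (runOneRound (outRule (compatibleMember τ)) nb ids L Ks)
  correct n G (outdeg≤β , _) ids _ L Ks (valid , noCollConflict) nb listing =
    (λ v → proj₂ (proj₂ (valid v)) _ (proj₁ (spec v))) ,
    Adjacent-elim G ¬Conflict-sym (λ {u} {v} u→v →
      All.lookup (proj₂ (spec u)) (∈-map⁺ Ks (adj⇒∈-outs u→v)) ∘ lose (proj₁ (spec v)))
    where
    open OutNeighbours G nb listing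
    out : Fin n → Subset c
    out = runOneRound (outRule (compatibleMember τ)) nb ids L Ks
    ¬Conflict-sym : Symmetric (λ u v → ¬ Conflict τ (out u) (out v))
    ¬Conflict-sym {u} {v} noConflict = noConflict ∘ Conflict-sym {C = out v}
    spec : ∀ v → out v ∈L Ks v × Compatible τ (map Ks (outs v)) (out v)
    spec v = subst (λ C → C ∈L Ks v × Compatible τ (map Ks (outs v)) C)
                   (sym (runOneRound-outRule (compatibleMember τ) nb ids L Ks v))
                   (compatibleMember-spec τ (Ks v) (map Ks (outs v))
                     (≤-trans excluded<βτ' (≤-reflexive (sym (proj₁ (proj₂ (valid v)))))))
      where
      excluded<βτ' : sum (map (λ K' → length (filter (conflictsWithSome? τ K') (Ks v))) (map Ks (outs v)))
                     < β * τ'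
      excluded<βτ' = sum-map-<-*
        (map⁺ (All.tabulate (λ u∈ →
          length-filter-conflicting< τ τ' (proj₁ (valid v)) (noCollConflict v _ (inj₁ (∈-outs⇒adj u∈))))))
        (length-map-outs≤ Ks outdeg≤β v)

lemma2 : (β c m : ℕ) → 1 ≤ β → 2 ≤ c → 2 ≤ m →
    (t l : ℕ) → IsCeilX β c m t → IsCeilLog β l →
    let τ  = t + 14
        τ' = 2 ^ (τ ∸ l)
        k  = β * τ
        k' = β * τ'
    in OneRoundReduction c (List (Subset c)) (Subset c)
         (MaxOutdeg β) (IsP2 τ k τ' k') (IsP1 τ k)
       × OneRoundReduction c (Subset c) (Fin c)
         (MaxOutdeg β) (IsP1 τ k) IsP0
lemma2 β c m β≥1 c≥2 _ t l _ _ =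
  p2⇒p1 c β τ (β * τ) (2 ^ (τ ∸ l)) {{β≢0}} {{m^n≢0 2 (τ ∸ l)}} ,
  p1⇒p0 c β τ {{β≢0}} {{≢-nonZero (m+1+n≢0 t)}} (fromℕ< c≥2)
  where
  τ : ℕ
  τ = t + 14
  β≢0 : NonZero β
  β≢0 = >-nonZero β≥1
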